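{- Let $G$ be a connected graph. For a linear ordering $\sigma$ of $V(G)$ and a vertex $v$, let $$f_\sigma(v)=|N(v)\cap\{u:\sigma(u)>\sigma(v)\}|-|N(v)\cap\{u:\sigma(u)<\sigma(v)\}|,$$ where $N(v)$ is the neighbourhood of $v$ and $\sigma(u)<\sigma(v)$ means $u$ precedes $v$. (i) If $G$ has at least one vertex of odd degree, then there exists an ordering $\sigma$ such that $f_\sigma(v)\ne 0$ for every vertex $v$. (ii) If all degrees in $G$ are even, then there exists an ordering $\sigma$ such that $f_\sigma(v)\neq 0$ for all but at most one vertex $v$; moreover, the vertex (if any) with $f_\sigma(v)=0$ can be prescribed to be any arbitrary vertex of $G$.
   Context: Graphs are finite, undirected, simple. -}

module Defs where

open import Data.Nat using (ℕ; zero; suc; _+_; _<_)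
open import Data.Fin using (Fin)
import Data.Fin
import Data.Product
open import Data.List using (List; []; _∷_)
open import Data.List.Base using (allFin)
open import Data.Integer using (ℤ; +_; _-_)
open import Data.Product using (_×_)
open import Relation.Nullary using (¬_; Dec; yes; no)
open import Relation.Binary using (Decidable)
open import Function.Bundles using (_↔_; Inverse)

record Graph (n : ℕ) : Set₁ where
  field
    Adj    : Fin n → Fin n → Set
    adj?   : Decidable Adj
    sym    : ∀ {u v} → Adj u v → Adj v u
    irrefl : ∀ {v} → ¬ Adj v v

open Graph public

countL : ∀ {n} {P : Fin n → Set} → (∀ x → Dec (P x)) → List (Fin n) → ℕ
countL P? [] = 0
countL P? (x ∷ xs) with P? x
... | yes _ = suc (countL P? xs)
... | no  _ = countL P? xs

count : ∀ {n} {P : Fin n → Set} → (∀ x → Dec (P x)) → ℕ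
count {n} P? = countL P? (allFin n)

degree : ∀ {n} (G : Graph n) → Fin n → ℕ
degree G v = count (adj? G v)

data Walk {n} (G : Graph n) : Fin n → Fin n → Set where
  []  : ∀ {u} → Walk G u u
  _∷_ : ∀ {u w v} → Adj G u w → Walk G w v → Walk G u v

Connected : ∀ {n} → Graph n → Set
Connected {n} G = (0 < n) × (∀ u v → Walk G u v)

-- a linear ordering of V(G): a bijection σ : V(G) → {0,…,n-1} (positions)
Ordering : ℕ → Set
Ordering n = Fin n ↔ Fin n

module _ {n} (G : Graph n) (σ : Ordering n) where
  private
    pos : Fin n → Fin n
    pos = Inverse.to σ

    dec× : ∀ {A B : Set} → Dec A → Dec B → Dec (A × B)
    dec× (yes a) (yes b) = yes (a Data.Product., b)
    dec× (no ¬a) _ = no λ p → ¬a (Data.Product.proj₁ p)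
    dec× (yes _) (no ¬b) = no λ p → ¬b (Data.Product.proj₂ p)

  later : Fin n → ℕ
  later v = count (λ u → dec× (adj? G v u) (pos v Data.Fin.<? pos u))

  earlier : Fin n → ℕ
  earlier v = count (λ u → dec× (adj? G v u) (pos u Data.Fin.<? pos v))

  f : Fin n → ℤ
  f v = + later v - + earlier v

-- Fix a root w. By connectivity the other vertices can be listed so that each has a
-- neighbour later in the list or equal to w. Place them in this order, each at the left or
-- the right end of the block of still unplaced vertices (which always contains w): left if
-- at most as many of its already placed neighbours lie on the left as on the right,
-- otherwise right. Its unplaced neighbour ends up on the far side, so the neighbours on
-- one side strictly outnumber those on the other, and f(v) ≠ 0 for every v ≠ w. A vertex of
-- odd degree cannot have f = 0 at all, so it serves as root in case (i).
module Submission where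

open import Defs hiding (sym)
open import Data.Nat using (ℕ; zero; suc; _+_; _*_; _≤_; _<_; z≤n; s≤s; _≤?_)
import Data.Nat.Properties as ℕ
open import Data.Nat.Divisibility using (_∣_; divides)
open import Data.Fin as Fin using (Fin; fromℕ<; punchOut)
import Data.Fin.Properties as Fin
open import Data.Integer as ℤ using (ℤ; +_; -[1+_]; +[1+_]; 0ℤ; ∣_∣; +<+; -<+; -<-)
import Data.Integer.Properties as ℤ
open import Data.List using (List; []; _∷_; length)
open import Data.List.Base using (allFin)
open import Data.List.Relation.Unary.Any using (here; there)
open import Data.List.Membership.Propositional using (_∈_; _∉_)
open import Data.List.Membership.Propositional.Properties using (∈-allFin)
open import Data.List.Properties using (length-tabulate)
open import Data.Product using (_×_; _,_; proj₁; proj₂; ∃-syntax)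
open import Data.Product.Relation.Binary.Lex.Strict using (×-strictTotalOrder)
open import Data.Sum using (_⊎_; inj₁; inj₂)
open import Data.Unit using (⊤; tt)
open import Data.Vec.Functional using (updateAt)
open import Data.Vec.Functional.Properties using (updateAt-updates; updateAt-minimal)
open import Function using (_∘_; id)
open import Function.Bundles using (Inverse; Injection; mk⤖)
open import Function.Consequences.Propositional using (strictlySurjective⇒surjective)
open import Function.Definitions using (Injective; StrictlySurjective)
open import Function.Properties.Bijection using (⤖⇒↔)
open import Function.Properties.Inverse using (↔⇒↣)
open import Level using (0ℓ)
open import Relation.Binary using (StrictTotalOrder; tri<; tri≈; tri>)
open import Relation.Binary.PropositionalEquality using (_≡_; _≢_; refl; sym; trans; cong; subst; subst₂; module ≡-Reasoning)
open import Relation.Nullary using (¬_; Dec; yes; no; contradiction)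
open import Relation.Nullary.Decidable using (_×-dec_; ¬?)

module _ {n} {P Q : Fin n → Set} (P? : ∀ x → Dec (P x)) (Q? : ∀ x → Dec (Q x)) where

  countL-mono : (∀ x → P x → Q x) → ∀ xs → countL P? xs ≤ countL Q? xs
  countL-mono P⇒Q [] = z≤n
  countL-mono P⇒Q (x ∷ xs) with P? x | Q? x
  ... | yes _ | yes _ = s≤s (countL-mono P⇒Q xs)
  ... | yes p | no ¬q = contradiction (P⇒Q x p) ¬q
  ... | no _  | yes _ = ℕ.m≤n⇒m≤1+n (countL-mono P⇒Q xs)
  ... | no _  | no _  = countL-mono P⇒Q xs

  countL-mono-< : (∀ x → P x → Q x) → ∀ {y xs} → y ∈ xs → Q y → ¬ P y →
                  countL P? xs < countL Q? xs
  countL-mono-< P⇒Q {xs = x ∷ xs} (here refl) qx ¬px with P? x | Q? x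
  ... | yes px | _     = contradiction px ¬px
  ... | no _   | yes _ = s≤s (countL-mono P⇒Q xs)
  ... | no _   | no ¬q = contradiction qx ¬q
  countL-mono-< P⇒Q {xs = x ∷ xs} (there y∈xs) qy ¬py with P? x | Q? x
  ... | yes _ | yes _ = s≤s (countL-mono-< P⇒Q y∈xs qy ¬py)
  ... | yes p | no ¬q = contradiction (P⇒Q x p) ¬q
  ... | no _  | yes _ = ℕ.m≤n⇒m≤1+n (countL-mono-< P⇒Q y∈xs qy ¬py)
  ... | no _  | no _  = countL-mono-< P⇒Q y∈xs qy ¬py

count-< : ∀ {n} {P : Fin n → Set} (P? : ∀ x → Dec (P x)) y → ¬ P y → count P? < n
count-< {n} P? y ¬py =
  subst (count P? <_) (trans (countL-⊤ (allFin n)) (length-tabulate id))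
        (countL-mono-< P? (λ _ → yes tt) (λ _ _ → tt) (∈-allFin y) tt ¬py)
  where
  countL-⊤ : ∀ xs → countL {P = λ _ → ⊤} (λ _ → yes tt) xs ≡ length xs
  countL-⊤ []       = refl
  countL-⊤ (_ ∷ xs) = cong suc (countL-⊤ xs)

countL-split : ∀ {n} {R P Q : Fin n → Set}
  (R? : ∀ x → Dec (R x)) (P? : ∀ x → Dec (P x)) (Q? : ∀ x → Dec (Q x)) →
  (∀ x → R x → P x ⊎ Q x) → (∀ x → P x → R x) → (∀ x → Q x → R x) →
  (∀ x → P x → ¬ Q x) → ∀ xs → countL R? xs ≡ countL P? xs + countL Q? xs
countL-split R? P? Q? R⇒P⊎Q P⇒R Q⇒R disjoint [] = refl
countL-split R? P? Q? R⇒P⊎Q P⇒R Q⇒R disjoint (x ∷ xs)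
  with R? x | P? x | Q? x | countL-split R? P? Q? R⇒P⊎Q P⇒R Q⇒R disjoint xs
... | _     | yes p | yes q | _  = contradiction q (disjoint x p)
... | yes _ | yes _ | no _  | ih = cong suc ih
... | yes _ | no _  | yes _ | ih = trans (cong suc ih) (sym (ℕ.+-suc _ _))
... | yes r | no ¬p | no ¬q | _  with R⇒P⊎Q x r
...   | inj₁ p = contradiction p ¬p
...   | inj₂ q = contradiction q ¬q
countL-split _ _ _ _ P⇒R _ _ (x ∷ _) | no ¬r | yes p | no _ | _ = contradiction (P⇒R x p) ¬r
countL-split _ _ _ _ _ Q⇒R _ (x ∷ _) | no ¬r | no _ | yes q | _ = contradiction (Q⇒R x q) ¬r
countL-split _ _ _ _ _ _ _ _         | no _  | no _ | no _  | ih = ih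

injective⇒strictlySurjective : ∀ {n} {g : Fin n → Fin n} →
  Injective _≡_ _≡_ g → StrictlySurjective _≡_ g
injective⇒strictlySurjective {suc m} {g} g-injective y with Fin.any? (λ x → g x Fin.≟ y)
... | yes hit = hit
... | no miss = contradiction (Fin.injective⇒≤ avoid-y-injective) ℕ.1+n≰n
  where
  y≢g : ∀ x → y ≢ g x
  y≢g x y≡gx = miss (x , sym y≡gx)

  avoid-y : Fin (suc m) → Fin m
  avoid-y x = punchOut (y≢g x)

  avoid-y-injective : Injective _≡_ _≡_ avoid-y
  avoid-y-injective eq = g-injective (Fin.punchOut-injective (y≢g _) (y≢g _) eq)

module Ranking {a ℓ} (O : StrictTotalOrder a ℓ 0ℓ) {n}
  (key : Fin n → StrictTotalOrder.Carrier O)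
  (key-injective : ∀ {u v} → StrictTotalOrder._≈_ O (key u) (key v) → u ≡ v) where

  open StrictTotalOrder O using (_<?_; compare) renaming (_<_ to _≺_; irrefl to ≺-irrefl; trans to ≺-trans)
  open StrictTotalOrder.Eq O using () renaming (refl to ≈-refl)

  rank : Fin n → Fin n
  rank v = fromℕ< (count-< (λ u → key u <? key v) v (≺-irrefl ≈-refl))

  rank-mono : ∀ {u v} → key u ≺ key v → rank u Fin.< rank v
  rank-mono {u} {v} u≺v = subst₂ _<_ (sym (Fin.toℕ-fromℕ< _)) (sym (Fin.toℕ-fromℕ< _))
    (countL-mono-< (λ x → key x <? key u) (λ x → key x <? key v)
      (λ x x≺u → ≺-trans x≺u u≺v) (∈-allFin u) u≺v (≺-irrefl ≈-refl))

  rank-injective : Injective _≡_ _≡_ rank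
  rank-injective {u} {v} eq with compare (key u) (key v)
  ... | tri< u≺v _ _ = contradiction eq (Fin.<⇒≢ (rank-mono u≺v))
  ... | tri≈ _ u≈v _ = key-injective u≈v
  ... | tri> _ _ v≺u = contradiction (sym eq) (Fin.<⇒≢ (rank-mono v≺u))

  ranking : Ordering n
  ranking = ⤖⇒↔ (mk⤖ (rank-injective ,
    strictlySurjective⇒surjective (injective⇒strictlySurjective rank-injective)))

-- Ties between equal keys are broken by the vertex index.
linearExtension : ∀ {a} (O : StrictTotalOrder a 0ℓ 0ℓ) {n} (K : Fin n → StrictTotalOrder.Carrier O) →
  ∃[ σ ] (∀ {u v} → StrictTotalOrder._<_ O (K u) (K v) → Inverse.to σ u Fin.< Inverse.to σ v)
linearExtension O {n} K = ranking , rank-mono ∘ inj₁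
  where open Ranking (×-strictTotalOrder O (Fin.<-strictTotalOrder n)) (λ u → K u , u) proj₂

walk-closed : ∀ {n} {G : Graph n} {S : Fin n → Set} → (∀ {u x} → Adj G u x → S x → S u) →
  ∀ {u v} → Walk G u v → S v → S u
walk-closed closed []             s = s
walk-closed closed (u~x ∷ x⇝v) s = closed u~x (walk-closed closed x⇝v s)

∣i∣≤k⇒-[1+k]<i : ∀ {i k} → ∣ i ∣ ≤ k → -[1+ k ] ℤ.< i
∣i∣≤k⇒-[1+k]<i {+ _}       _   = -<+
∣i∣≤k⇒-[1+k]<i { -[1+ _ ]} m<k = -<- m<k

∣i∣≤k⇒i<+[1+k] : ∀ {i k} → ∣ i ∣ ≤ k → i ℤ.< +[1+ k ]
∣i∣≤k⇒i<+[1+k] {+ _}       m≤k = +<+ (s≤s m≤k)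
∣i∣≤k⇒i<+[1+k] { -[1+ _ ]} _   = -<+

m+m≡m*2 : ∀ m → m + m ≡ m * 2
m+m≡m*2 m = trans (cong (λ k → m + k) (sym (ℕ.+-identityʳ m))) (ℕ.*-comm 2 m)

module _ {n} (G : Graph n) where

  open import Data.List.Membership.DecPropositional (Fin._≟_ {n}) using (_∈?_)

  f≡0⇒later≡earlier : ∀ σ v → f G σ v ≡ + 0 → later G σ v ≡ earlier G σ v
  f≡0⇒later≡earlier σ v = ℤ.+-injective ∘ ℤ.i-j≡0⇒i≡j _ _

  degree≡later+earlier : ∀ σ v → degree G v ≡ later G σ v + earlier G σ v
  degree≡later+earlier σ v = countL-split _ _ _ before-or-after (λ _ → proj₁) (λ _ → proj₁)
    (λ _ (_ , v<u) (_ , u<v) → Fin.<-asym v<u u<v) (allFin n)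
    where
    open Inverse σ using (to)
    before-or-after : ∀ u → Adj G v u → (Adj G v u × to v Fin.< to u) ⊎ (Adj G v u × to u Fin.< to v)
    before-or-after u v~u with Fin.<-cmp (to v) (to u)
    ... | tri< v<u _ _ = inj₁ (v~u , v<u)
    ... | tri≈ _ v≡u _ = contradiction (subst (Adj G v) (sym (Injection.injective (↔⇒↣ σ) v≡u)) v~u) (irrefl G)
    ... | tri> _ _ u<v = inj₂ (v~u , u<v)

  odd-degree⇒f≢0 : ∀ σ v → ¬ (2 ∣ degree G v) → f G σ v ≢ + 0
  odd-degree⇒f≢0 σ v odd f≡0 = odd (divides (later G σ v) (begin
    degree G v                      ≡⟨ degree≡later+earlier σ v ⟩
    later G σ v + earlier G σ v     ≡⟨ cong (λ k → later G σ v + k) (sym (f≡0⇒later≡earlier σ v f≡0)) ⟩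
    later G σ v + later G σ v       ≡⟨ m+m≡m*2 (later G σ v) ⟩
    later G σ v * 2                 ∎))
    where open ≡-Reasoning

  nbrCount : {P : Fin n → Set} → Fin n → (∀ u → Dec (P u)) → ℕ
  nbrCount v P? = count (λ u → adj? G v u ×-dec P? u)

  Unbalanced : (Fin n → ℤ) → Fin n → Set
  Unbalanced K v =
    nbrCount v (λ u → K u ℤ.≤? K v) < nbrCount v (λ u → K v ℤ.<? K u) ⊎
    nbrCount v (λ u → K v ℤ.≤? K u) < nbrCount v (λ u → K u ℤ.<? K v)

  module _ (σ : Ordering n) (K : Fin n → ℤ)
    (extends : ∀ {u v} → K u ℤ.< K v → Inverse.to σ u Fin.< Inverse.to σ v) where

    open Inverse σ using (to)

    before⇒key-≤ : ∀ {u v} → to u Fin.< to v → K u ℤ.≤ K v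
    before⇒key-≤ u<v = ℤ.≮⇒≥ (λ Kv<Ku → Fin.<-asym u<v (extends Kv<Ku))

    unbalanced⇒f≢0 : ∀ {v} → Unbalanced K v → f G σ v ≢ + 0
    unbalanced⇒f≢0 {v} unbalanced f≡0 with unbalanced
    ... | inj₁ lt = ℕ.<-irrefl (sym (f≡0⇒later≡earlier σ v f≡0)) (begin-strict
      earlier G σ v                        ≤⟨ countL-mono _ _ (λ _ (v~u , u<v) → v~u , before⇒key-≤ u<v) (allFin n) ⟩
      nbrCount v (λ u → K u ℤ.≤? K v)     <⟨ lt ⟩
      nbrCount v (λ u → K v ℤ.<? K u)     ≤⟨ countL-mono _ _ (λ _ (v~u , Kv<Ku) → v~u , extends Kv<Ku) (allFin n) ⟩
      later G σ v                          ∎)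
      where open ℕ.≤-Reasoning
    ... | inj₂ lt = ℕ.<-irrefl (f≡0⇒later≡earlier σ v f≡0) (begin-strict
      later G σ v                          ≤⟨ countL-mono _ _ (λ _ (v~u , v<u) → v~u , before⇒key-≤ v<u) (allFin n) ⟩
      nbrCount v (λ u → K v ℤ.≤? K u)     <⟨ lt ⟩
      nbrCount v (λ u → K u ℤ.<? K v)     ≤⟨ countL-mono _ _ (λ _ (v~u , Ku<Kv) → v~u , extends Ku<Kv) (allFin n) ⟩
      earlier G σ v                        ∎)
      where open ℕ.≤-Reasoning

  front back : (Fin n → ℤ) → Fin n → ℕ
  front A v = nbrCount v (λ u → A u ℤ.<? 0ℤ)
  back  A v = nbrCount v (λ u → 0ℤ ℤ.<? A u)

  -- Positions are encoded by keys: a vertex placed while k vertices are still to come gets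
  -- key -(k+1) (left) or k+1 (right), unplaced vertices keep key 0, so later placements lie
  -- nearer the middle.
  side : (Fin n → ℤ) → Fin n → ℕ → ℤ
  side A v k with front A v ≤? back A v
  ... | yes _ = -[1+ k ]
  ... | no  _ = +[1+ k ]

  ∣side∣ : ∀ A v k → ∣ side A v k ∣ ≡ suc k
  ∣side∣ A v k with front A v ≤? back A v
  ... | yes _ = refl
  ... | no  _ = refl

  keys : (Fin n → ℤ) → List (Fin n) → Fin n → ℤ
  keys A []       = A
  keys A (v ∷ vs) = keys (updateAt A v (λ _ → side A v (length vs))) vs

  keys-outside : ∀ A vs {u} → u ∉ vs → keys A vs u ≡ A u
  keys-outside A []       _   = refl
  keys-outside A (v ∷ vs) u∉ = trans (keys-outside _ vs (u∉ ∘ there)) (updateAt-minimal _ v A (u∉ ∘ here))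

  keys-bounded : ∀ A vs {u} → u ∈ vs → ∣ keys A vs u ∣ ≤ length vs
  keys-bounded A (v ∷ vs) (there u∈vs) = ℕ.m≤n⇒m≤1+n (keys-bounded _ vs u∈vs)
  keys-bounded A (v ∷ vs) (here refl) with v ∈? vs
  ... | yes v∈vs = ℕ.m≤n⇒m≤1+n (keys-bounded _ vs v∈vs)
  ... | no  v∉vs = ℕ.≤-reflexive (begin
    ∣ keys A′ vs v ∣                 ≡⟨ cong ∣_∣ (keys-outside A′ vs v∉vs) ⟩
    ∣ A′ v ∣                         ≡⟨ cong ∣_∣ (updateAt-updates v A) ⟩
    ∣ side A v (length vs) ∣         ≡⟨ ∣side∣ A v (length vs) ⟩
    suc (length vs)                  ∎)
    where
    open ≡-Reasoning
    A′ = updateAt A v (λ _ → side A v (length vs))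

  -- A: the keys when v is placed with k vertices to come; K: the final keys.
  unbalanced : ∀ A K v k {p} → K v ≡ side A v k →
    (∀ u → Adj G v u → ∣ K u ∣ ≤ k ⊎ K u ≡ A u) →
    Adj G v p → A p ≡ 0ℤ → Unbalanced K v
  unbalanced A K v k {p} Kv near v~p Ap≡0 with front A v ≤? back A v
  ... | yes front≤back = inj₁ (begin-strict
    nbrCount v (λ u → K u ℤ.≤? K v)  ≤⟨ countL-mono _ _ (λ u (v~u , Ku≤Kv) → v~u ,
                                          ℤ.≰⇒> (λ 0≤Au → ℤ.<⇒≱ (after-v v~u 0≤Au) Ku≤Kv)) (allFin n) ⟩
    front A v                        ≤⟨ front≤back ⟩
    back A v                         <⟨ countL-mono-< _ _ (λ u (v~u , 0<Au) → v~u , after-v v~u (ℤ.<⇒≤ 0<Au))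
                                          (∈-allFin p) (v~p , after-v v~p (ℤ.≤-reflexive (sym Ap≡0)))
                                          (λ (_ , 0<Ap) → ℤ.<-irrefl (sym Ap≡0) 0<Ap) ⟩
    nbrCount v (λ u → K v ℤ.<? K u)  ∎)
    where
    open ℕ.≤-Reasoning
    after-v : ∀ {u} → Adj G v u → 0ℤ ℤ.≤ A u → K v ℤ.< K u
    after-v {u} v~u 0≤Au with near u v~u
    ... | inj₁ inner = subst (ℤ._< K u) (sym Kv) (∣i∣≤k⇒-[1+k]<i inner)
    ... | inj₂ Ku≡Au = subst₂ ℤ._<_ (sym Kv) (sym Ku≡Au) (ℤ.<-≤-trans -<+ 0≤Au)
  ... | no front≰back = inj₂ (begin-strict
    nbrCount v (λ u → K v ℤ.≤? K u)  ≤⟨ countL-mono _ _ (λ u (v~u , Kv≤Ku) → v~u ,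
                                          ℤ.≰⇒> (λ Au≤0 → ℤ.<⇒≱ (before-v v~u Au≤0) Kv≤Ku)) (allFin n) ⟩
    back A v                         <⟨ ℕ.≰⇒> front≰back ⟩
    front A v                        ≤⟨ countL-mono _ _ (λ u (v~u , Au<0) → v~u , before-v v~u (ℤ.<⇒≤ Au<0)) (allFin n) ⟩
    nbrCount v (λ u → K u ℤ.<? K v)  ∎)
    where
    open ℕ.≤-Reasoning
    before-v : ∀ {u} → Adj G v u → A u ℤ.≤ 0ℤ → K u ℤ.< K v
    before-v {u} v~u Au≤0 with near u v~u
    ... | inj₁ inner = subst (K u ℤ.<_) (sym Kv) (∣i∣≤k⇒i<+[1+k] inner)
    ... | inj₂ Ku≡Au = subst₂ ℤ._<_ (sym Ku≡Au) (sym Kv) (ℤ.≤-<-trans Au≤0 (+<+ (s≤s z≤n)))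

  module _ (w : Fin n) where

    data TowardsRoot : List (Fin n) → Set where
      []   : TowardsRoot []
      step : ∀ {v p vs} → v ∉ w ∷ vs → Adj G v p → p ∈ w ∷ vs → TowardsRoot vs → TowardsRoot (v ∷ vs)

    private
      skip : ∀ {u v vs} → u ∈ w ∷ vs → u ∈ w ∷ v ∷ vs
      skip (here u≡w)  = here u≡w
      skip (there u∈vs) = there (there u∈vs)

    towardsRoot : (∀ u → Walk G u w) → ∃[ vs ] TowardsRoot vs × (∀ u → u ∈ w ∷ vs)
    towardsRoot walks = grow n [] [] (count-< outside? w (λ w∉ → w∉ (here refl)))
      where
      outside? : ∀ {vs} u → Dec (u ∉ w ∷ vs)
      outside? u = ¬? (u ∈? _)

      grow : ∀ fuel vs → TowardsRoot vs → count (outside? {vs}) < fuel →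
             ∃[ vs′ ] TowardsRoot vs′ × (∀ u → u ∈ w ∷ vs′)
      grow zero       _  _  ()
      grow (suc fuel) vs tr bound
        with Fin.any? (λ v → outside? v ×-dec Fin.any? (λ p → adj? G v p ×-dec (p ∈? w ∷ vs)))
      ... | yes (v , v∉ , p , v~p , p∈) = grow fuel (v ∷ vs) (step v∉ v~p p∈ tr) (ℕ.<-≤-trans shrinks (ℕ.≤-pred bound))
        where
        shrinks : count (outside? {v ∷ vs}) < count (outside? {vs})
        shrinks = countL-mono-< _ _ (λ _ u∉ u∈ → u∉ (skip u∈)) (∈-allFin v) v∉ (λ v∉′ → v∉′ (there (here refl)))
      ... | no stuck = vs , tr , λ u → walk-closed closed (walks u) (here refl)
        where
        closed : ∀ {u x} → Adj G u x → x ∈ w ∷ vs → u ∈ w ∷ vs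
        closed {u} {x} u~x x∈ with u ∈? w ∷ vs
        ... | yes u∈ = u∈
        ... | no  u∉ = contradiction (u , u∉ , x , u~x , x∈) stuck

    keys-unbalanced : ∀ A {vs} → TowardsRoot vs → (∀ {u} → u ∈ w ∷ vs → A u ≡ 0ℤ) →
      ∀ {v} → v ∈ vs → Unbalanced (keys A vs) v
    keys-unbalanced A (step {v} {p} {vs} v∉ v~p p∈ _) A≡0 (here refl) =
      unbalanced A (keys A′ vs) v (length vs) Kv near v~p (A≡0 (skip p∈))
      where
      A′ = updateAt A v (λ _ → side A v (length vs))
      Kv : keys A′ vs v ≡ side A v (length vs)
      Kv = trans (keys-outside A′ vs (v∉ ∘ there)) (updateAt-updates v A)
      near : ∀ u → Adj G v u → ∣ keys A′ vs u ∣ ≤ length vs ⊎ keys A′ vs u ≡ A u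
      near u v~u with u ∈? vs
      ... | yes u∈vs = inj₁ (keys-bounded A′ vs u∈vs)
      ... | no  u∉vs = inj₂ (trans (keys-outside A′ vs u∉vs) (updateAt-minimal u v A λ { refl → irrefl G v~u }))
    keys-unbalanced A (step {v} {vs = vs} v∉ _ _ rest) A≡0 (there u∈vs) = keys-unbalanced _ rest A′≡0 u∈vs
      where
      A′≡0 : ∀ {u} → u ∈ w ∷ vs → updateAt A v (λ _ → side A v (length vs)) u ≡ 0ℤ
      A′≡0 u∈ = trans (updateAt-minimal _ v A λ { refl → v∉ u∈ }) (A≡0 (skip u∈))

  nonzeroOffRoot : Connected G → ∀ w → ∃[ σ ] (∀ v → v ≢ w → f G σ v ≢ + 0)
  nonzeroOffRoot (_ , walk) w with towardsRoot w (λ u → walk u w)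
  ... | vs , tr , covers with linearExtension ℤ.<-strictTotalOrder (keys (λ _ → 0ℤ) vs)
  ...   | σ , extends = σ , λ v v≢w →
          unbalanced⇒f≢0 σ _ extends (keys-unbalanced w _ tr (λ _ → refl) (member v v≢w))
    where
    member : ∀ v → v ≢ w → v ∈ vs
    member v v≢w with covers v
    ... | here v≡w = contradiction v≡w v≢w
    ... | there v∈vs = v∈vs

  atMostOneZero : ∀ {w} → ∃[ σ ] (∀ v → v ≢ w → f G σ v ≢ + 0) →
    ∃[ σ ] (∀ v v′ → f G σ v ≡ + 0 → f G σ v′ ≡ + 0 → v ≡ v′)
  atMostOneZero {w} (σ , off-w) = σ , λ v v′ fv≡0 fv′≡0 → trans (isRoot v fv≡0) (sym (isRoot v′ fv′≡0))
    where
    isRoot : ∀ u → f G σ u ≡ + 0 → u ≡ w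
    isRoot u fu≡0 with u Fin.≟ w
    ... | yes u≡w = u≡w
    ... | no  u≢w = contradiction fu≡0 (off-w u u≢w)

  nonzeroEverywhere : ∀ {x} → ¬ (2 ∣ degree G x) → ∃[ σ ] (∀ v → v ≢ x → f G σ v ≢ + 0) →
    ∃[ σ ] (∀ v → f G σ v ≢ + 0)
  nonzeroEverywhere {x} odd (σ , off-x) = σ , λ v → nonzeroAt (v Fin.≟ x)
    where
    nonzeroAt : ∀ {v} → Dec (v ≡ x) → f G σ v ≢ + 0
    nonzeroAt (yes refl) = odd-degree⇒f≢0 σ x odd
    nonzeroAt (no v≢x)   = off-x _ v≢x

theorem2 : ∀ {n} (G : Graph n) → Connected G →
  ((∃[ v ] ¬ (2 ∣ degree G v)) →
     ∃[ σ ] (∀ v → f G σ v ≢ + 0))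
  ×
  ((∀ v → 2 ∣ degree G v) →
     (∃[ σ ] (∀ v w → f G σ v ≡ + 0 → f G σ w ≡ + 0 → v ≡ w))
     × (∀ (w : Fin n) → ∃[ σ ] (∀ v → v ≢ w → f G σ v ≢ + 0)))
theorem2 G connected@(0<n , _) =
  (λ (x , odd) → nonzeroEverywhere G odd (nonzeroOffRoot G connected x)) ,
  λ _ → atMostOneZero G (nonzeroOffRoot G connected (fromℕ< 0<n)) , nonzeroOffRoot G connected
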